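{- Let $k$ be a positive integer. A $k$-harmonic graph on $n$ vertices has at most $nk/2$ edges, and this maximum is attained if and only if the graph is regular.
   Context: All graphs are finite, simple and without isolated vertices. For a vertex $i$, $d_i$ is its degree and $m_i=d_i^{ -1}\sum_{j:\, ji\in E(G)} d_j$ is its average $2$-degree. A graph is $k$-harmonic if $m_i=k$ for every vertex $i$. -}

module Defs where

open import Data.Nat using (ℕ; _+_; _*_; _≤_; _<_)
open import Data.Bool using (Bool; true; false; if_then_else_; _∧_)
open import Data.Fin using (Fin) renaming (_<?_ to _<ᶠ?_)
open import Data.List using (List; map; allFin)
open import Data.Nat.ListAction using (sum)
open import Relation.Binary.PropositionalEquality using (_≡_)
open import Relation.Nullary using (¬_)
open import Relation.Nullary.Decidable using (⌊_⌋)

record Graph (n : ℕ) : Set where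
  field
    adj   : Fin n → Fin n → Bool
    sym   : ∀ i j → adj i j ≡ adj j i
    irrefl : ∀ i → adj i i ≡ false

open Graph public

Σ-Fin : (n : ℕ) → (Fin n → ℕ) → ℕ
Σ-Fin n f = sum (map f (allFin n))

deg : ∀ {n} → Graph n → Fin n → ℕ
deg {n} G i = Σ-Fin n (λ j → if adj G i j then 1 else 0)

-- Σ_{j ~ i} d_j   (so that m_i = d_i⁻¹ · neighbourDegSum G i)
neighbourDegSum : ∀ {n} → Graph n → Fin n → ℕ
neighbourDegSum {n} G i = Σ-Fin n (λ j → if adj G i j then deg G j else 0)

edgeCount : ∀ {n} → Graph n → ℕ
edgeCount {n} G =
  Σ-Fin n (λ i → Σ-Fin n (λ j → if adj G i j ∧ ⌊ i <ᶠ? j ⌋ then 1 else 0))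

NoIsolated : ∀ {n} → Graph n → Set
NoIsolated G = ∀ i → 1 ≤ deg G i

-- k-harmonic: m_i = k for every vertex i, i.e. Σ_{j~i} d_j = k · d_i
-- (equivalent to d_i⁻¹ Σ_{j~i} d_j = k because d_i ≥ 1).
Harmonic : ∀ {n} → ℕ → Graph n → Set
Harmonic k G = ∀ i → neighbourDegSum G i ≡ k * deg G i

Regular : ∀ {n} → Graph n → Set
Regular G = ∀ i j → deg G i ≡ deg G j

module Submission where

-- Write d i for the degree of vertex i, S = Σ d i and n for the
-- number of vertices.  By the handshake lemma S = 2·|E|, and by exchanging
-- the order of summation Σᵢ Σ_{j~i} d j = Σⱼ d j², so k-harmonicity gives
-- Σ d i² = k·S.  Summing the AM–GM inequality 2·k·d i ≤ k² + d i² over all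
-- vertices yields 2kS ≤ nk² + kS, i.e. kS ≤ k·nk, hence S ≤ nk; if S = nk
-- every AM–GM instance is tight, so d i = k for all i and G is regular.
-- Conversely, if G is regular of degree d then harmonicity at any vertex
-- reads d² = k·d, so d = k (as d ≥ 1) and S = nk.

open import Defs hiding (sym)
open import Data.Nat using (ℕ; _*_; _≤_)
open import Data.Product using (_×_)
open import Relation.Binary.PropositionalEquality using (_≡_)

open import Data.Nat using (zero; suc; _+_; ∣_-_∣; NonZero; >-nonZero)
open import Data.Nat.Properties
open import Data.Nat.Tactic.RingSolver using (solve-∀)
open import Data.Product using (_,_)
open import Data.Sum using (inj₁; inj₂)
open import Data.Bool using (Bool; true; false; if_then_else_; _∧_)
open import Data.Fin using (Fin) renaming (_<?_ to _<ᶠ?_)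
import Data.Fin.Properties as Finₚ
open import Data.List using (tabulate)
open import Data.List.Properties using (map-tabulate)
import Data.Nat.ListAction as List
open import Data.Empty using (⊥-elim)
open import Relation.Nullary using (yes; no)
open import Relation.Nullary.Decidable using (⌊_⌋)
open import Relation.Binary.PropositionalEquality
  using (_≢_; refl; sym; trans; cong; cong₂; subst₂)
open import Function using (_∘_; id)
open import Algebra.Properties.Semiring.Sum +-*-semiring
  using (sum; sum-syntax; sum-cong-≗; ∑-distrib-+; ∑-comm; *-distribˡ-sum)
open Relation.Binary.PropositionalEquality.≡-Reasoning

sum-tabulate : ∀ {n} (f : Fin n → ℕ) → List.sum (tabulate f) ≡ sum f
sum-tabulate {zero}  f = refl
sum-tabulate {suc n} f = cong (f Fin.zero +_) (sum-tabulate (f ∘ Fin.suc))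

Σ-Fin≡∑ : ∀ n (f : Fin n → ℕ) → Σ-Fin n f ≡ ∑[ i < n ] f i
Σ-Fin≡∑ n f = trans (cong List.sum (map-tabulate id f)) (sum-tabulate f)

∑-const : ∀ n c → ∑[ i < n ] c ≡ n * c
∑-const zero    c = refl
∑-const (suc n) c = cong (c +_) (∑-const n c)

∑-scale : ∀ {n} c (f : Fin n → ℕ) → ∑[ i < n ] (c * f i) ≡ c * sum f
∑-scale c f = sym (*-distribˡ-sum c f)

∑-mono-≤ : ∀ {n} {f g : Fin n → ℕ} → (∀ i → f i ≤ g i) → sum f ≤ sum g
∑-mono-≤ {zero}  f≤g = ≤-refl
∑-mono-≤ {suc n} f≤g = +-mono-≤ (f≤g Fin.zero) (∑-mono-≤ (f≤g ∘ Fin.suc))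

+-tight : ∀ {a b c d} → a ≤ b → c ≤ d → a + c ≡ b + d → a ≡ b × c ≡ d
+-tight {a} {b} {c} {d} a≤b c≤d a+c≡b+d = a≡b , +-cancelˡ-≡ b c d b+c≡b+d
  where
  a≡b : a ≡ b
  a≡b = ≤-antisym a≤b (+-cancelʳ-≤ c b a
          (≤-trans (+-monoʳ-≤ b c≤d) (≤-reflexive (sym a+c≡b+d))))
  b+c≡b+d : b + c ≡ b + d
  b+c≡b+d = trans (cong (_+ c) (sym a≡b)) a+c≡b+d

∑-tight : ∀ {n} {f g : Fin n → ℕ} → (∀ i → f i ≤ g i) → sum f ≡ sum g →
          ∀ i → f i ≡ g i
∑-tight {suc n} f≤g sum≡ with +-tight (f≤g Fin.zero) (∑-mono-≤ (f≤g ∘ Fin.suc)) sum≡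
... | head≡ , tail≡ = λ where
  Fin.zero    → head≡
  (Fin.suc i) → ∑-tight (f≤g ∘ Fin.suc) tail≡ i

square-gap : ∀ a b → a * a + b * b ≡ 2 * (a * b) + ∣ a - b ∣ * ∣ a - b ∣
square-gap zero    b       = refl
square-gap (suc a) zero    = gap-zero (suc a)
  where
  gap-zero : ∀ x → x * x + 0 * 0 ≡ 2 * (x * 0) + x * x
  gap-zero = solve-∀
square-gap (suc a) (suc b) = begin
  suc a * suc a + suc b * suc b      ≡⟨ expand a b ⟩
  (a * a + b * b) + 2 * (suc a + b)  ≡⟨ cong (_+ 2 * (suc a + b)) (square-gap a b) ⟩
  (2 * (a * b) + c²) + 2 * (suc a + b) ≡⟨ collect a b c² ⟩
  2 * (suc a * suc b) + c²           ∎
  where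
  c² = ∣ a - b ∣ * ∣ a - b ∣
  expand : ∀ a b → suc a * suc a + suc b * suc b ≡ (a * a + b * b) + 2 * (suc a + b)
  expand = solve-∀
  collect : ∀ a b c → (2 * (a * b) + c) + 2 * (suc a + b) ≡ 2 * (suc a * suc b) + c
  collect = solve-∀

am-gm : ∀ a b → 2 * (a * b) ≤ a * a + b * b
am-gm a b = ≤-trans (m≤m+n _ _) (≤-reflexive (sym (square-gap a b)))

am-gm-tight : ∀ a b → 2 * (a * b) ≡ a * a + b * b → a ≡ b
am-gm-tight a b tight = ∣m-n∣≡0⇒m≡n c≡0
  where
  c = ∣ a - b ∣
  c²≡0 : c * c ≡ 0
  c²≡0 = sym (+-cancelˡ-≡ (2 * (a * b)) 0 (c * c)
           (trans (+-identityʳ _) (trans tight (square-gap a b))))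
  c≡0 : c ≡ 0
  c≡0 with m*n≡0⇒m≡0∨n≡0 c c²≡0
  ... | inj₁ c≡0 = c≡0
  ... | inj₂ c≡0 = c≡0

module MeanSquare {n : ℕ} (x : Fin n → ℕ) (k : ℕ)
                  (squares : ∑[ i < n ] (x i * x i) ≡ k * ∑[ i < n ] x i) where

  S : ℕ
  S = ∑[ i < n ] x i

  ∑-products : ∑[ i < n ] (2 * (k * x i)) ≡ 2 * (k * S)
  ∑-products = trans (∑-scale 2 (λ i → k * x i)) (cong (2 *_) (∑-scale k x))

  ∑-squares : ∑[ i < n ] (k * k + x i * x i) ≡ n * (k * k) + k * S
  ∑-squares = trans (∑-distrib-+ (λ _ → k * k) (λ i → x i * x i))
                    (cong₂ _+_ (∑-const n (k * k)) squares)

  summed-am-gm : 2 * (k * S) ≤ n * (k * k) + k * S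
  summed-am-gm = subst₂ _≤_ ∑-products ∑-squares (∑-mono-≤ (λ i → am-gm k (x i)))

  mean-square-bound : .{{NonZero k}} → S ≤ n * k
  mean-square-bound = *-cancelˡ-≤ k (≤-trans kS≤nkk (≤-reflexive (reorder n k)))
    where
    kS≤nkk : k * S ≤ n * (k * k)
    kS≤nkk = +-cancelʳ-≤ (k * S) (k * S) (n * (k * k))
               (≤-trans (≤-reflexive (sym (double (k * S)))) summed-am-gm)
      where
      double : ∀ m → 2 * m ≡ m + m
      double = solve-∀
    reorder : ∀ n k → n * (k * k) ≡ k * (n * k)
    reorder = solve-∀

  mean-square-tight : S ≡ n * k → ∀ i → x i ≡ k
  mean-square-tight S≡nk i = sym (am-gm-tight k (x i) (∑-tight (λ i → am-gm k (x i)) sums≡ i))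
    where
    balance : ∀ n k → 2 * (k * (n * k)) ≡ n * (k * k) + k * (n * k)
    balance = solve-∀
    sums≡ : ∑[ i < n ] (2 * (k * x i)) ≡ ∑[ i < n ] (k * k + x i * x i)
    sums≡ = begin
      ∑[ i < n ] (2 * (k * x i))      ≡⟨ ∑-products ⟩
      2 * (k * S)                     ≡⟨ cong (λ s → 2 * (k * s)) S≡nk ⟩
      2 * (k * (n * k))               ≡⟨ balance n k ⟩
      n * (k * k) + k * (n * k)       ≡⟨ cong (λ s → n * (k * k) + k * s) (sym S≡nk) ⟩
      n * (k * k) + k * S             ≡⟨ sym ∑-squares ⟩
      ∑[ i < n ] (k * k + x i * x i)  ∎

indicator : Bool → ℕ
indicator b = if b then 1 else 0

exactly-one-less : ∀ {n} (i j : Fin n) → i ≢ j →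
                   indicator ⌊ i <ᶠ? j ⌋ + indicator ⌊ j <ᶠ? i ⌋ ≡ 1
exactly-one-less i j i≢j with i <ᶠ? j | j <ᶠ? i
... | yes i<j | yes j<i = ⊥-elim (Finₚ.<-asym i<j j<i)
... | yes _   | no _    = refl
... | no _    | yes _   = refl
... | no i≮j  | no j≮i  = ⊥-elim (i≢j (Finₚ.≤-antisym (≮⇒≥ j≮i) (≮⇒≥ i≮j)))

if-as-product : ∀ b y → (if b then y else 0) ≡ y * indicator b
if-as-product false y = sym (*-zeroʳ y)
if-as-product true  y = sym (*-identityʳ y)

module _ {n : ℕ} (G : Graph n) where

  orientedEdge : Fin n → Fin n → ℕ
  orientedEdge i j = indicator (adj G i j ∧ ⌊ i <ᶠ? j ⌋)

  edge-orientations : ∀ i j → indicator (adj G i j) ≡ orientedEdge i j + orientedEdge j i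
  edge-orientations i j rewrite Graph.sym G j i with adj G i j in i~j
  ... | false = refl
  ... | true  = sym (exactly-one-less i j i≢j)
    where
    i≢j : i ≢ j
    i≢j refl with () ← trans (sym i~j) (Graph.irrefl G i)

  deg-∑ : ∀ i → deg G i ≡ ∑[ j < n ] indicator (adj G i j)
  deg-∑ i = Σ-Fin≡∑ n _

  deg-column : ∀ j → ∑[ i < n ] indicator (adj G i j) ≡ deg G j
  deg-column j = sym (trans (deg-∑ j) (sum-cong-≗ (λ i → cong indicator (Graph.sym G j i))))

  handshake : ∑[ i < n ] deg G i ≡ 2 * edgeCount G
  handshake = begin
    ∑[ i < n ] deg G i
      ≡⟨ sum-cong-≗ (λ i → trans (deg-∑ i) (sum-cong-≗ (edge-orientations i))) ⟩
    ∑[ i < n ] ∑[ j < n ] (orientedEdge i j + orientedEdge j i)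
      ≡⟨ sum-cong-≗ (λ i → ∑-distrib-+ (orientedEdge i) (λ j → orientedEdge j i)) ⟩
    ∑[ i < n ] (E i + ∑[ j < n ] orientedEdge j i)
      ≡⟨ ∑-distrib-+ E (λ i → ∑[ j < n ] orientedEdge j i) ⟩
    sum E + ∑[ i < n ] ∑[ j < n ] orientedEdge j i
      ≡⟨ cong (sum E +_) (∑-comm (λ i j → orientedEdge j i)) ⟩
    sum E + sum E
      ≡⟨ cong (sum E +_) (sym (+-identityʳ (sum E))) ⟩
    2 * sum E
      ≡⟨ cong (2 *_) (sym edgeCount-∑) ⟩
    2 * edgeCount G ∎
    where
    E : Fin n → ℕ
    E i = ∑[ j < n ] orientedEdge i j
    edgeCount-∑ : edgeCount G ≡ sum E
    edgeCount-∑ = trans (Σ-Fin≡∑ n _) (sum-cong-≗ (λ i → Σ-Fin≡∑ n (orientedEdge i)))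

  neighbourDegSum-∑ : ∀ i → neighbourDegSum G i ≡ ∑[ j < n ] (deg G j * indicator (adj G i j))
  neighbourDegSum-∑ i = trans (Σ-Fin≡∑ n _) (sum-cong-≗ (λ j → if-as-product (adj G i j) (deg G j)))

  -- Every vertex j contributes d j once for each of its d j neighbours:
  -- Σᵢ Σ_{j~i} d j = Σⱼ d j².
  ∑-neighbourDegSum : ∑[ i < n ] neighbourDegSum G i ≡ ∑[ j < n ] (deg G j * deg G j)
  ∑-neighbourDegSum = begin
    ∑[ i < n ] neighbourDegSum G i
      ≡⟨ sum-cong-≗ neighbourDegSum-∑ ⟩
    ∑[ i < n ] ∑[ j < n ] (deg G j * indicator (adj G i j))
      ≡⟨ ∑-comm (λ i j → deg G j * indicator (adj G i j)) ⟩
    ∑[ j < n ] ∑[ i < n ] (deg G j * indicator (adj G i j))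
      ≡⟨ sum-cong-≗ (λ j → ∑-scale (deg G j) (λ i → indicator (adj G i j))) ⟩
    ∑[ j < n ] (deg G j * ∑[ i < n ] indicator (adj G i j))
      ≡⟨ sum-cong-≗ (λ j → cong (deg G j *_) (deg-column j)) ⟩
    ∑[ j < n ] (deg G j * deg G j) ∎

  regular-neighbourDegSum : Regular G → ∀ i → neighbourDegSum G i ≡ deg G i * deg G i
  regular-neighbourDegSum regular i = begin
    neighbourDegSum G i
      ≡⟨ neighbourDegSum-∑ i ⟩
    ∑[ j < n ] (deg G j * indicator (adj G i j))
      ≡⟨ sum-cong-≗ (λ j → cong (_* indicator (adj G i j)) (regular j i)) ⟩
    ∑[ j < n ] (deg G i * indicator (adj G i j))
      ≡⟨ ∑-scale (deg G i) (λ j → indicator (adj G i j)) ⟩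
    deg G i * ∑[ j < n ] indicator (adj G i j)
      ≡⟨ cong (deg G i *_) (sym (deg-∑ i)) ⟩
    deg G i * deg G i ∎

module _ {n k : ℕ} (G : Graph n) (harmonic : Harmonic k G) where

  harmonic-square-sum : ∑[ i < n ] (deg G i * deg G i) ≡ k * ∑[ i < n ] deg G i
  harmonic-square-sum = begin
    ∑[ i < n ] (deg G i * deg G i) ≡⟨ sym (∑-neighbourDegSum G) ⟩
    ∑[ i < n ] neighbourDegSum G i ≡⟨ sum-cong-≗ harmonic ⟩
    ∑[ i < n ] (k * deg G i)       ≡⟨ ∑-scale k (deg G) ⟩
    k * ∑[ i < n ] deg G i         ∎

  -- A regular k-harmonic graph without isolated vertices is k-regular:
  -- harmonicity at i reads dᵢ² = k dᵢ with dᵢ ≥ 1.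
  regular-harmonic-degree : NoIsolated G → Regular G → ∀ i → deg G i ≡ k
  regular-harmonic-degree noIsolated regular i =
    *-cancelʳ-≡ (deg G i) k (deg G i) {{>-nonZero (noIsolated i)}}
      (trans (sym (regular-neighbourDegSum G regular i)) (harmonic i))

proposition4p2 : (k n : ℕ) → 1 ≤ k → (G : Graph n) → NoIsolated G → Harmonic k G →
    (2 * edgeCount G ≤ n * k)
      × ((2 * edgeCount G ≡ n * k → Regular G) × (Regular G → 2 * edgeCount G ≡ n * k))
proposition4p2 k n 1≤k G noIsolated harmonic =
  edge-bound , (regular-if-extremal , extremal-if-regular)
  where
  open MeanSquare (deg G) k (harmonic-square-sum {k = k} G harmonic)

  edge-bound : 2 * edgeCount G ≤ n * k
  edge-bound = subst₂ _≤_ (handshake G) refl (mean-square-bound {{>-nonZero 1≤k}})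

  regular-if-extremal : 2 * edgeCount G ≡ n * k → Regular G
  regular-if-extremal extremal i j = trans (all-k i) (sym (all-k j))
    where
    all-k : ∀ i → deg G i ≡ k
    all-k = mean-square-tight (trans (handshake G) extremal)

  extremal-if-regular : Regular G → 2 * edgeCount G ≡ n * k
  extremal-if-regular regular = begin
    2 * edgeCount G    ≡⟨ sym (handshake G) ⟩
    ∑[ i < n ] deg G i ≡⟨ sum-cong-≗ (regular-harmonic-degree {k = k} G harmonic noIsolated regular) ⟩
    ∑[ i < n ] k       ≡⟨ ∑-const n k ⟩
    n * k              ∎
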